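{- Let $(S,s)$ be an $\omega$-stable symétron and $A\subseteq S$ a definable indecomposable subset. Then for every $x\in S$, the set $s(A,x)=\{s(a,x):a\in A\}$ is a definable indecomposable subset.
   Context: A symétron is a set $S$ with a binary operation $s$ such that for all $x,y,z$: $s(x,x)=x$; $s(s(x,y),y)=x$; $s(s(x,z),s(y,z))=s(s(x,y),z)$; and for all $x,y$ there is a unique $z$ with $s(x,z)=y$. Definable means definable with parameters. A subset $Y$ is convex if $s(x,y)\in Y$ for all $x,y\in Y$. A definable set $A$ is indecomposable if for every finite family $X_1,\dots,X_n$ of pairwise disjoint definable convex subsets, $A\subseteq X_1\cup\dots\cup X_n$ implies $A\subseteq X_i$ for some $i$. -}

module Defs where

open import Data.Nat using (ℕ; zero; suc)
open import Data.Fin using (Fin; zero; suc)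
open import Data.Bool using (Bool; true; false)
open import Data.List using (List; []; _∷_)
open import Data.Product using (Σ; _×_; _,_)
open import Data.Empty using (⊥)
open import Relation.Binary.PropositionalEquality using (_≡_)
open import Relation.Nullary using (¬_)

record Symetron : Set₁ where
  field
    Carrier : Set
    s       : Carrier → Carrier → Carrier
    idem    : ∀ x → s x x ≡ x
    invol   : ∀ x y → s (s x y) y ≡ x
    distr   : ∀ x y z → s (s x z) (s y z) ≡ s (s x y) z
    uniq    : ∀ x y → Σ Carrier λ z → (s x z ≡ y) × (∀ z′ → s x z′ ≡ y → z′ ≡ z)

module _ (𝕊 : Symetron) where
  open Symetron 𝕊

  data Term (n : ℕ) : Set where
    var   : Fin n → Term n
    param : Carrier → Term n
    app   : Term n → Term n → Term n

  data Formula (n : ℕ) : Set where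
    _≐_  : Term n → Term n → Formula n
    neg  : Formula n → Formula n
    _∧_  : Formula n → Formula n → Formula n
    ex   : Formula (suc n) → Formula n

  extend : {n : ℕ} → Carrier → (Fin n → Carrier) → Fin (suc n) → Carrier
  extend a ρ zero    = a
  extend a ρ (suc i) = ρ i

  eval : {n : ℕ} → (Fin n → Carrier) → Term n → Carrier
  eval ρ (var i)   = ρ i
  eval ρ (param c) = c
  eval ρ (app t u) = s (eval ρ t) (eval ρ u)

  Sat : {n : ℕ} → (Fin n → Carrier) → Formula n → Set
  Sat ρ (t ≐ u)  = eval ρ t ≡ eval ρ u
  Sat ρ (neg φ)  = ¬ Sat ρ φ
  Sat ρ (φ ∧ ψ)  = Sat ρ φ × Sat ρ ψ
  Sat ρ (ex φ)   = Σ Carrier λ a → Sat (extend a ρ) φ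

  Holds : Formula 1 → Carrier → Set
  Holds φ a = Sat (λ _ → a) φ

  Subset : Set₁
  Subset = Carrier → Set

  Definable : Subset → Set
  Definable P = Σ (Formula 1) λ φ → ∀ a → (P a → Holds φ a) × (Holds φ a → P a)

  Convex : Subset → Set
  Convex Y = ∀ x y → Y x → Y y → Y (s x y)

  Indecomposable : Subset → Set₁
  Indecomposable A =
    (n : ℕ) (X : Fin n → Subset) →
    (∀ i → Definable (X i)) →
    (∀ i → Convex (X i)) →
    (∀ i j → ¬ (i ≡ j) → ∀ a → X i a → X j a → ⊥) →
    (∀ a → A a → Σ (Fin n) λ i → X i a) →
    Σ (Fin n) λ i → ∀ a → A a → X i a

  -- A binary tree of formulas with parameters (indexed by finite 0/1 words,
  -- the head of the list being the last letter): every node is realised,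
  -- children imply their parent, and the two children are contradictory.
  IsBinaryTree : (List Bool → Formula 1) → Set
  IsBinaryTree φ =
    (∀ σ → Σ Carrier λ a → Holds (φ σ) a) ×
    (∀ b σ a → Holds (φ (b ∷ σ)) a → Holds (φ σ) a) ×
    (∀ σ a → Holds (φ (true ∷ σ)) a → Holds (φ (false ∷ σ)) a → ⊥)

  -- ω-stable (the language {s} is countable, so ω-stable = totally
  -- transcendental = no binary tree of consistent formulas with parameters).
  OmegaStable : Set
  OmegaStable = ¬ (Σ (List Bool → Formula 1) IsBinaryTree)

  translate : Subset → Carrier → Subset
  translate A x b = Σ Carrier λ a → A a × (b ≡ s a x)

-- Right translation y ↦ s(y, x) is given by a term and, by the self-distributivity
-- axiom, is an endomorphism of the symétron. Images under term maps are definable, and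
-- preimages under definable endomorphisms of definable convex sets are again definable
-- and convex.
{-# OPTIONS --safe #-}
module Submission where

open import Defs
open import Data.Product using (_×_; Σ; _,_; proj₁; proj₂; map₂)
open import Data.Nat using (ℕ)
open import Data.Fin using (Fin; zero; suc; lift)
open import Data.Product.Function.NonDependent.Propositional using (_×-⇔_)
open import Function using (_∘_; const; _⇔_; mk⇔; Equivalence)
open import Relation.Nullary.Negation using (contraposition)
open import Relation.Binary.PropositionalEquality
  using (_≡_; _≗_; refl; sym; trans; cong₂; subst)
import Algebra.Morphism.Definitions as MorphismDefinitions

open Equivalence using (to; from)

module _ (𝕊 : Symetron) where
  open Symetron 𝕊
  open MorphismDefinitions Carrier Carrier _≡_ using (Homomorphic₂)

  private variable
    n m : ℕ

  renameTerm : (Fin n → Fin m) → Term 𝕊 n → Term 𝕊 m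
  renameTerm r (var i)   = var (r i)
  renameTerm r (param c) = param c
  renameTerm r (app t u) = app (renameTerm r t) (renameTerm r u)

  rename : (Fin n → Fin m) → Formula 𝕊 n → Formula 𝕊 m
  rename r (t ≐ u) = renameTerm r t ≐ renameTerm r u
  rename r (neg φ) = neg (rename r φ)
  rename r (φ ∧ ψ) = rename r φ ∧ rename r ψ
  rename r (ex φ)  = ex (rename (lift 1 r) φ)

  eval-renameTerm : (r : Fin n → Fin m) {ρ : Fin m → Carrier} {ρ′ : Fin n → Carrier} →
    ρ ∘ r ≗ ρ′ → ∀ t → eval 𝕊 ρ (renameTerm r t) ≡ eval 𝕊 ρ′ t
  eval-renameTerm r eq (var i)   = eq i
  eval-renameTerm r eq (param c) = refl
  eval-renameTerm r eq (app t u) = cong₂ s (eval-renameTerm r eq t) (eval-renameTerm r eq u)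

  Sat-rename : (r : Fin n → Fin m) {ρ : Fin m → Carrier} {ρ′ : Fin n → Carrier} →
    ρ ∘ r ≗ ρ′ → ∀ φ → Sat 𝕊 ρ (rename r φ) ⇔ Sat 𝕊 ρ′ φ
  Sat-rename r eq (t ≐ u) = mk⇔
    (λ p → trans (sym (eval-renameTerm r eq t)) (trans p (eval-renameTerm r eq u)))
    (λ p → trans (eval-renameTerm r eq t) (trans p (sym (eval-renameTerm r eq u))))
  Sat-rename r eq (neg φ) = mk⇔
    (contraposition (from (Sat-rename r eq φ)))
    (contraposition (to (Sat-rename r eq φ)))
  Sat-rename r eq (φ ∧ ψ) = Sat-rename r eq φ ×-⇔ Sat-rename r eq ψ
  Sat-rename r {ρ} {ρ′} eq (ex φ) = mk⇔
    (map₂ λ {a} → to (Sat-rename (lift 1 r) (eq-extend a) φ))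
    (map₂ λ {a} → from (Sat-rename (lift 1 r) (eq-extend a) φ))
    where
      eq-extend : ∀ a → extend 𝕊 a ρ ∘ lift 1 r ≗ extend 𝕊 a ρ′
      eq-extend a zero    = refl
      eq-extend a (suc i) = eq i

  Definable-resp : {P Q : Subset 𝕊} → (∀ a → P a ⇔ Q a) → Definable 𝕊 P → Definable 𝕊 Q
  Definable-resp P⇔Q (φ , P⇔φ) =
    φ , λ a → (λ Qa → proj₁ (P⇔φ a) (from (P⇔Q a) Qa)) , (λ φa → to (P⇔Q a) (proj₂ (P⇔φ a) φa))

  -- ψ is read with the bound witness a as variable 0 and the defined element b as variable 1.
  Definable-∃ : {P : Subset 𝕊} (ψ : Formula 𝕊 2) → Definable 𝕊 P →
    Definable 𝕊 (λ b → Σ Carrier λ a → P a × Sat 𝕊 (extend 𝕊 a (const b)) ψ)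
  Definable-∃ {P} ψ (φ , P⇔φ) = ex (rename (const zero) φ ∧ ψ) , λ b →
      (λ { (a , Pa , ψab) → a , from (φ-at a b) (proj₁ (P⇔φ a) Pa) , ψab })
    , (λ { (a , φa , ψab) → a , proj₂ (P⇔φ a) (to (φ-at a b) φa) , ψab })
    where
      φ-at : ∀ a b → Sat 𝕊 (extend 𝕊 a (const b)) (rename (const zero) φ) ⇔ Holds 𝕊 φ a
      φ-at a b = Sat-rename (const zero) (λ _ → refl) φ

  ⟦_⟧ : Term 𝕊 1 → Carrier → Carrier
  ⟦ t ⟧ a = eval 𝕊 (const a) t

  image : (Carrier → Carrier) → Subset 𝕊 → Subset 𝕊
  image f A b = Σ Carrier λ a → A a × (b ≡ f a)

  Definable-image : {A : Subset 𝕊} (t : Term 𝕊 1) → Definable 𝕊 A → Definable 𝕊 (image ⟦ t ⟧ A)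
  Definable-image t dA =
    Definable-resp (λ b → mk⇔ (map₂ (map₂ (λ eq → trans eq (t-at _ b))))
                              (map₂ (map₂ (λ eq → trans eq (sym (t-at _ b))))))
      (Definable-∃ (var (suc zero) ≐ renameTerm (const zero) t) dA)
    where
      t-at : ∀ a b → eval 𝕊 (extend 𝕊 a (const b)) (renameTerm (const zero) t) ≡ ⟦ t ⟧ a
      t-at a b = eval-renameTerm (const zero) (λ _ → refl) t

  Definable-preimage : {P : Subset 𝕊} (t : Term 𝕊 1) → Definable 𝕊 P → Definable 𝕊 (P ∘ ⟦ t ⟧)
  Definable-preimage {P} t dP =
    Definable-resp (λ b → mk⇔ (λ { (a , Pa , eq) → subst P (trans eq (t-at a b)) Pa })
                              (λ Ptb → ⟦ t ⟧ b , Ptb , sym (t-at _ b)))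
      (Definable-∃ (var zero ≐ renameTerm (const (suc zero)) t) dP)
    where
      t-at : ∀ a b → eval 𝕊 (extend 𝕊 a (const b)) (renameTerm (const (suc zero)) t) ≡ ⟦ t ⟧ b
      t-at a b = eval-renameTerm (const (suc zero)) (λ _ → refl) t

  Convex-preimage : {X : Subset 𝕊} {f : Carrier → Carrier} →
    Homomorphic₂ f s s → Convex 𝕊 X → Convex 𝕊 (X ∘ f)
  Convex-preimage {X} hom convex y z Xfy Xfz = subst X (sym (hom y z)) (convex _ _ Xfy Xfz)

  Indecomposable-image : {A : Subset 𝕊} (t : Term 𝕊 1) → Homomorphic₂ ⟦ t ⟧ s s →
    Indecomposable 𝕊 A → Indecomposable 𝕊 (image ⟦ t ⟧ A)
  Indecomposable-image t hom indecA n X definable convex disjoint covers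
    with indecA n (λ i → X i ∘ ⟦ t ⟧)
           (λ i → Definable-preimage t (definable i))
           (λ i → Convex-preimage hom (convex i))
           (λ i j i≢j a → disjoint i j i≢j (⟦ t ⟧ a))
           (λ a Aa → covers (⟦ t ⟧ a) (a , Aa , refl))
  ... | i , A⊆Xi∘t = i , λ { b (a , Aa , refl) → A⊆Xi∘t a Aa }

  rightTranslation : Carrier → Term 𝕊 1
  rightTranslation x = app (var zero) (param x)

  rightTranslation-homomorphic : ∀ x → Homomorphic₂ ⟦ rightTranslation x ⟧ s s
  rightTranslation-homomorphic x y z = sym (distr y z x)

mainTheorem9 : (𝕊 : Symetron) → OmegaStable 𝕊 →
    (A : Subset 𝕊) → Definable 𝕊 A → Indecomposable 𝕊 A →
    (x : Symetron.Carrier 𝕊) →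
    Definable 𝕊 (translate 𝕊 A x) × Indecomposable 𝕊 (translate 𝕊 A x)
mainTheorem9 𝕊 _ A definableA indecA x =
    Definable-image 𝕊 (rightTranslation 𝕊 x) definableA
  , Indecomposable-image 𝕊 (rightTranslation 𝕊 x) (rightTranslation-homomorphic 𝕊 x) indecA
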